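{- Let $(S,\prec,\lhd)$ be a Burling set and $y\in S$. Then for every path $x_0x_1\cdots x_k$ in the graph $(S,E_\lhd)$ such that $x_0\prec y$ and $x_k\not\prec y$, there is an index $i\in\{1,\dots,k\}$ such that $x_i\lhd y$.
   Context: A Burling set is a triple $(S,\prec,\lhd)$ where $S$ is a non-empty finite set, $\prec$ is a strict partial order on $S$, $\lhd$ is an acyclic relation on $S$, and for all $x,y,z\in S$: (A1) if $x\prec y$, $x\prec z$, $y\ne z$, then $y\prec z$ or $z\prec y$; (A2) if $x\lhd y$, $x\lhd z$, $y\neq z$, then $y\prec z$ or $z\prec y$; (A3) if $x\lhd y$ and $x\prec z$, then $y\prec z$; (A4) if $x\lhd y$ and $y\prec z$, then $x\lhd z$ or $x\prec z$. The graph $(S,E_\lhd)$ has vertex set $S$ and edges $xy$ for all $x,y$ with $x\lhd y$; a path $x_0\cdots x_k$ is a sequence of distinct vertices with $x_{j-1}x_j$ an edge for each $j$. -}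

module Defs where

open import Data.Nat using (ℕ; suc; NonZero)
open import Data.Fin using (Fin; zero; suc; inject₁)
open import Data.Product using (Σ; ∃; _×_; _,_)
open import Data.Sum using (_⊎_)
open import Relation.Nullary using (¬_)
open import Relation.Binary.PropositionalEquality using (_≡_; _≢_)
open import Relation.Binary.Construct.Closure.Transitive using (TransClosure)
open import Function.Definitions using (Injective)

record BurlingSet (n : ℕ) : Set₁ where
  field
    nonEmpty : NonZero n
    _≺_ : Fin n → Fin n → Set
    _◁_ : Fin n → Fin n → Set
    ≺-irrefl : ∀ x → ¬ (x ≺ x)
    ≺-trans : ∀ {x y z} → x ≺ y → y ≺ z → x ≺ z
    ◁-acyclic : ∀ x → ¬ TransClosure _◁_ x x
    A1 : ∀ {x y z} → x ≺ y → x ≺ z → y ≢ z → (y ≺ z) ⊎ (z ≺ y)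
    A2 : ∀ {x y z} → x ◁ y → x ◁ z → y ≢ z → (y ≺ z) ⊎ (z ≺ y)
    A3 : ∀ {x y z} → x ◁ y → x ≺ z → y ≺ z
    A4 : ∀ {x y z} → x ◁ y → y ≺ z → (x ◁ z) ⊎ (x ≺ z)

Edge : ∀ {n} → BurlingSet n → Fin n → Fin n → Set
Edge B x y = (x ◁ y) ⊎ (y ◁ x)
  where open BurlingSet B

IsPath : ∀ {n} → BurlingSet n → (k : ℕ) → (Fin (suc k) → Fin n) → Set
IsPath B k x =
  Injective _≡_ _≡_ x × (∀ (j : Fin k) → Edge B (x (inject₁ j)) (x (suc j)))

module Submission where

-- Walking along an edge from a vertex below y, axiom (A3) or (A4) shows the
-- next vertex is again below y unless it is ◁ y.  Since the path starts below
-- y and ends elsewhere, it must leave the set of vertices below y through a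
-- vertex ◁ y.

open import Defs
open import Data.Nat using (ℕ; zero; suc)
open import Data.Fin using (Fin; zero; suc; fromℕ; inject₁)
open import Data.Product using (∃; _,_; proj₂; map)
open import Data.Sum using (_⊎_; inj₁; inj₂)
open import Function using (id; _∘_)
open import Relation.Nullary using (¬_; contradiction)

module _ {n} (B : BurlingSet n) where
  open BurlingSet B

  ◁⊎≺-along-edge : ∀ {x z y} → Edge B x z → x ≺ y → (z ◁ y) ⊎ (z ≺ y)
  ◁⊎≺-along-edge (inj₁ x◁z) x≺y = inj₂ (A3 x◁z x≺y)
  ◁⊎≺-along-edge (inj₂ z◁x) x≺y = A4 z◁x x≺y

  walk-leaving-≺-meets-◁ : ∀ {y} k (x : Fin (suc k) → Fin n) →
    (∀ (j : Fin k) → Edge B (x (inject₁ j)) (x (suc j))) →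
    x zero ≺ y → ¬ x (fromℕ k) ≺ y → ∃ λ (i : Fin k) → x (suc i) ◁ y
  walk-leaving-≺-meets-◁ zero    x edges x₀≺y ¬xₖ≺y = contradiction x₀≺y ¬xₖ≺y
  walk-leaving-≺-meets-◁ (suc k) x edges x₀≺y ¬xₖ≺y
    with ◁⊎≺-along-edge (edges zero) x₀≺y
  ... | inj₁ x₁◁y = zero , x₁◁y
  ... | inj₂ x₁≺y =
    map suc id (walk-leaving-≺-meets-◁ k (x ∘ suc) (edges ∘ suc) x₁≺y ¬xₖ≺y)

mainTheorem6 : ∀ {n} (B : BurlingSet n) (y : Fin n) (k : ℕ) (x : Fin (suc k) → Fin n) →
    IsPath B k x →
    BurlingSet._≺_ B (x zero) y →
    ¬ BurlingSet._≺_ B (x (fromℕ k)) y →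
    ∃ λ (i : Fin k) → BurlingSet._◁_ B (x (suc i)) y
mainTheorem6 B y k x path = walk-leaving-≺-meets-◁ B k x (proj₂ path)
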